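{- Let $b\ge 1$ and $d\ge 1$ be integers. If Blocker wins the $b$-biased prefix game on the infinite $d$-dimensional wedge, then Blocker wins the $(b+1)$-biased prefix game on the infinite $(d+1)$-dimensional wedge.
   Context: The infinite $d$-dimensional wedge is the poset of nonnegative integer $d$-tuples ordered coordinatewise, rooted at $(0,\dots,0)$. In the $b$-biased $k$-prefix game on it, Walker moves first and then players alternate, Walker choosing one unchosen element per turn and Blocker choosing $b$ unchosen elements per turn; Walker wins if he chooses, in this order in time, elements $x_0,x_1,\dots,x_{k-1}$ with $x_0$ the zero tuple and each $x_i$ obtained from $x_{i-1}$ by increasing one coordinate by $1$. Blocker wins the $b$-biased prefix game if Blocker has a winning strategy in the $b$-biased $k$-prefix game for some $k$. -}

module Defs where

open import Data.Nat using (ℕ; zero; suc)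
open import Data.Fin using (Fin)
open import Data.Vec using (Vec; replicate; updateAt; toList)
open import Data.List using (List; []; _∷_; _++_; length; reverse)
open import Data.List.Membership.Propositional using (_∉_)
open import Data.List.Relation.Unary.Unique.Propositional using (Unique)
open import Data.List.Relation.Binary.Sublist.Propositional using (_⊆_)
open import Data.Product using (Σ; ∃; ∃-syntax; _×_)
open import Data.Unit using (⊤)
open import Relation.Binary.PropositionalEquality using (_≡_)
open import Relation.Nullary using (¬_)

-- Elements of the infinite d-dimensional wedge: nonnegative integer d-tuples.
Point : ℕ → Set
Point d = Vec ℕ d

origin : (d : ℕ) → Point d
origin d = replicate d 0

Cover : {d : ℕ} → Point d → Point d → Set
Cover {d} x y = Σ (Fin d) λ i → y ≡ updateAt x i suc

WalkFrom : {d : ℕ} → Point d → List (Point d) → Set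
WalkFrom x [] = ⊤
WalkFrom x (y ∷ ys) = Cover x y × WalkFrom y ys

PrefixPath : {d : ℕ} → List (Point d) → Set
PrefixPath [] = ⊤
PrefixPath {d} (x ∷ xs) = (x ≡ origin d) × WalkFrom x xs

-- Walker's moves ws (in chronological order) contain, as a subsequence in time,
-- a prefix path of length k.
WalkerWins : {d : ℕ} → ℕ → List (Point d) → Set
WalkerWins k ws = ∃[ xs ] (length xs ≡ k × PrefixPath xs × xs ⊆ ws)

-- A Blocker strategy (b-biased): given Walker's move history (newest first,
-- including Walker's current move), choose b elements.
BStrategy : ℕ → ℕ → Set
BStrategy b d = List (Point d) → Vec (Point d) b

blocked : {b d : ℕ} → BStrategy b d → List (Point d) → List (Point d)
blocked σ [] = []
blocked σ (w ∷ ws) = toList (σ (w ∷ ws)) ++ blocked σ ws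

Legal : {b d : ℕ} → BStrategy b d → List (Point d) → Set
Legal σ [] = ⊤
Legal σ (w ∷ ws) = Legal σ ws × w ∉ ws × w ∉ blocked σ ws

-- σ wins the b-biased k-prefix game: against every legal Walker play, Blocker's
-- choices are always b distinct unchosen elements, and Walker never wins.
WinningBlocker : (b d k : ℕ) → BStrategy b d → Set
WinningBlocker b d k σ =
  (ws : List (Point d)) → Legal σ ws →
    ((w : Point d) (vs : List (Point d)) → ws ≡ w ∷ vs →
       Unique (toList (σ (w ∷ vs)) ++ (w ∷ vs) ++ blocked σ vs))
    × ¬ WalkerWins k (reverse ws)

BlockerWinsPrefix : ℕ → ℕ → Set
BlockerWinsPrefix b d = ∃[ k ] ∃[ σ ] WinningBlocker b d k σ

-- Blocker plays a winning b-biased strategy σ of the d-wedge inside the hyperplane of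
-- (d+1)-tuples with first coordinate 0.  When Walker takes (0, p), Blocker answers with
-- σ's reply to the first-coordinate-0 moves so far, lifted to the hyperplane, and spends
-- his extra choice on (1, p); every other Walker move is answered far away.  So (1, p) is
-- chosen (by Blocker, or earlier by Walker) before Walker could step from (0, p) to it:
-- a prefix path never leaves the hyperplane, hence it is a prefix path of the play seen
-- by σ, which Walker cannot complete.
module Submission where

open import Defs
open import Data.Nat using (ℕ; zero; suc; _+_; _≤_; _<_; z≤n; s≤s; _≟_)
open import Data.Nat.Properties
  using ( ≤-refl; ≤-trans; ≤-reflexive; <⇒≤; <⇒≱; <-irrefl; <-≤-trans; n≮n; n≤1+n
        ; m≤m+n; m≤n+m; m<m+n; +-suc)
open import Data.Fin using () renaming (zero to fzero; suc to fsuc)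
open import Data.Vec as Vec using (Vec; []; _∷_; replicate; updateAt; toList; head)
open import Data.Vec.Properties using (≡-dec; toList-map; ∷-injectiveʳ)
open import Data.List as List using (List; []; _∷_; _++_; reverse)
open import Data.List.Properties using (length-map; reverse-map; reverse-involutive)
open import Data.List.Membership.Propositional using (_∈_; _∉_)
open import Data.List.Membership.Propositional.Properties
  using (∈-map⁻; ∈-map⁺; ∈-++⁻; ∈-++⁺ˡ; ∈-++⁺ʳ)
open import Data.List.Relation.Unary.Any using (here; there)
open import Data.List.Relation.Unary.All as All using ()
open import Data.List.Relation.Unary.All.Properties using (¬Any⇒All¬; ++⁻ˡ; ++⁻ʳ)
open import Data.List.Relation.Unary.AllPairs using ([]; _∷_)
open import Data.List.Relation.Unary.Unique.Propositional using (Unique)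
import Data.List.Relation.Unary.Unique.Propositional.Properties as Unique
open import Data.List.Relation.Binary.Disjoint.Propositional using (Disjoint)
open import Data.List.Relation.Binary.Sublist.Propositional
  using (_⊆_; []; _∷_; _∷ʳ_; minimum; ⊆-trans; to∈)
open import Data.List.Relation.Binary.Sublist.Propositional.Properties using (∷ˡ⁻; reverse⁺; reverse⁻)
open import Data.Product using (∃-syntax; _×_; _,_; proj₁; proj₂)
open import Data.Sum as Sum using (_⊎_; inj₁; inj₂; [_,_])
open import Data.Unit using (tt)
open import Data.Empty using (⊥; ⊥-elim)
open import Function using (_∘_)
open import Relation.Nullary using (¬_; yes; no)
open import Relation.Binary.PropositionalEquality
  using (_≡_; refl; sym; trans; cong; subst; subst₂)

Unique-++⁻ : ∀ {A : Set} (xs : List A) {ys : List A} → Unique (xs ++ ys) → Unique xs × Disjoint xs ys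
Unique-++⁻ [] _ = [] , λ ()
Unique-++⁻ (x ∷ xs) (x∉ ∷ u) with Unique-++⁻ xs u
... | unique-xs , disjoint-xs = ++⁻ˡ xs x∉ ∷ unique-xs , disjoint
  where
  disjoint : Disjoint (x ∷ xs) _
  disjoint (here refl , j) = All.lookup (++⁻ʳ xs x∉) j refl
  disjoint (there i , j) = disjoint-xs (i , j)

module _ {b d : ℕ} (τ : BStrategy b d) where

  RespondsFreshly : Set
  RespondsFreshly = ∀ w ws → Legal τ (w ∷ ws) →
    Unique (toList (τ (w ∷ ws))) × Disjoint (toList (τ (w ∷ ws))) ((w ∷ ws) ++ blocked τ ws)

  Blocks : ℕ → Set
  Blocks k = ∀ ws → Legal τ ws → ¬ WalkerWins k (reverse ws)

module _ {b d : ℕ} {τ : BStrategy b d} (responds : RespondsFreshly τ) where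

  legal⇒choicesDistinct : ∀ ws → Legal τ ws →
    Unique ws × Unique (blocked τ ws) × Disjoint ws (blocked τ ws)
  legal⇒choicesDistinct [] _ = [] , [] , λ ()
  legal⇒choicesDistinct (w ∷ ws) (legal , w∉ws , w∉blocked)
    with legal⇒choicesDistinct ws legal | responds w ws (legal , w∉ws , w∉blocked)
  ... | unique-ws , unique-blocked , disjoint-ws | unique-reply , reply-disjoint =
    ¬Any⇒All¬ ws w∉ws ∷ unique-ws ,
    Unique.++⁺ unique-reply unique-blocked (λ (i , j) → reply-disjoint (i , ∈-++⁺ʳ (w ∷ ws) j)) ,
    disjoint
    where
    disjoint : Disjoint (w ∷ ws) (blocked τ (w ∷ ws))
    disjoint (i , j) with ∈-++⁻ (toList (τ (w ∷ ws))) j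
    ... | inj₁ j′ = reply-disjoint (j′ , ∈-++⁺ˡ i)
    disjoint (here refl , _) | inj₂ j′ = w∉blocked j′
    disjoint (there i , _) | inj₂ j′ = disjoint-ws (i , j′)

  respondsFreshly⇒unique : ∀ w ws → Legal τ (w ∷ ws) →
    Unique (toList (τ (w ∷ ws)) ++ (w ∷ ws) ++ blocked τ ws)
  respondsFreshly⇒unique w ws legal
    with legal⇒choicesDistinct (w ∷ ws) legal | legal⇒choicesDistinct ws (proj₁ legal) | responds w ws legal
  ... | unique-w∷ws , _ , disjoint-w∷ws | _ , unique-blocked , _ | unique-reply , reply-disjoint =
    Unique.++⁺ unique-reply
      (Unique.++⁺ unique-w∷ws unique-blocked
        (λ (i , j) → disjoint-w∷ws (i , ∈-++⁺ʳ (toList (τ (w ∷ ws))) j)))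
      reply-disjoint

winning⇒respondsFreshly×blocks : ∀ {b d k} {τ : BStrategy b d} →
  WinningBlocker b d k τ → RespondsFreshly τ × Blocks τ k
winning⇒respondsFreshly×blocks win =
  (λ w ws legal → Unique-++⁻ _ (proj₁ (win (w ∷ ws) legal) w ws refl)) ,
  (λ ws legal → proj₂ (win ws legal))

respondsFreshly×blocks⇒winning : ∀ {b d k} {τ : BStrategy b d} →
  RespondsFreshly τ → Blocks τ k → WinningBlocker b d k τ
respondsFreshly×blocks⇒winning responds blocks ws legal =
  (λ { w vs refl → respondsFreshly⇒unique responds w vs legal }) , blocks ws legal

module Lift {b d : ℕ} (σ : BStrategy b d) where

  open import Data.List.Membership.DecPropositional (≡-dec {n = suc d} _≟_) using (_∈?_)

  ground : Point d → Point (suc d)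
  ground p = 0 ∷ p

  groundMoves : List (Point (suc d)) → List (Point d)
  groundMoves [] = []
  groundMoves ((zero ∷ p) ∷ ws) = p ∷ groundMoves ws
  groundMoves ((suc _ ∷ _) ∷ ws) = groundMoves ws

  far : ℕ → Point (suc d)
  far m = m ∷ replicate d 0

  farBlock : ℕ → (n : ℕ) → Vec (Point (suc d)) n
  farBlock m zero = []
  farBlock m (suc n) = far m ∷ farBlock (suc m) n

  weight : List (Point (suc d)) → ℕ
  weight [] = 0
  weight (w ∷ ws) = weight ws + suc b + head w

  -- Every element chosen so far has first coordinate below  fresh ws + suc b;
  -- the offset 2 keeps far points away from first coordinates 0 and 1.
  fresh : List (Point (suc d)) → ℕ
  fresh ws = 2 + weight ws

  cap : Point d → List (Point (suc d)) → Point (suc d)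
  cap p ws with (1 ∷ p) ∈? ws
  ... | yes _ = far (fresh (ground p ∷ ws))
  ... | no _ = 1 ∷ p

  -- The reply to the empty history is never consulted.
  τ : BStrategy (suc b) (suc d)
  τ [] = replicate (suc b) (far 0)
  τ ((zero ∷ p) ∷ ws) = cap p ws ∷ Vec.map ground (σ (p ∷ groundMoves ws))
  τ (w@(suc _ ∷ _) ∷ ws) = farBlock (fresh (w ∷ ws)) (suc b)

  ∈-farBlock : ∀ m n {x} → x ∈ toList (farBlock m n) → m ≤ head x × head x < m + n
  ∈-farBlock m (suc n) (here refl) = ≤-refl , m<m+n m (s≤s z≤n)
  ∈-farBlock m (suc n) (there i) with ∈-farBlock (suc m) n i
  ... | m<x , x<m+n = <⇒≤ m<x , ≤-trans x<m+n (≤-reflexive (sym (+-suc m n)))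

  farBlock-unique : ∀ m n → Unique (toList (farBlock m n))
  farBlock-unique m zero = []
  farBlock-unique m (suc n) =
    ¬Any⇒All¬ _ (λ i → n≮n m (proj₁ (∈-farBlock (suc m) n i))) ∷ farBlock-unique (suc m) n

  fresh+b<fresh-∷ : ∀ w ws → fresh ws + suc b ≤ fresh (w ∷ ws)
  fresh+b<fresh-∷ w ws = s≤s (s≤s (m≤m+n _ (head w)))

  ∈⇒head<fresh : ∀ ws {x} → x ∈ ws → head x < fresh ws
  ∈⇒head<fresh (w ∷ ws) (here refl) = s≤s (≤-trans (m≤n+m (head w) _) (n≤1+n _))
  ∈⇒head<fresh (w ∷ ws) (there i) =
    <-≤-trans (∈⇒head<fresh ws i) (≤-trans (m≤m+n _ (suc b)) (fresh+b<fresh-∷ w ws))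

  data Reply (w : Point (suc d)) (ws : List (Point (suc d))) : Point (suc d) → Set where
    lifted : ∀ {p y} → w ≡ ground p → y ∈ toList (σ (p ∷ groundMoves ws)) → Reply w ws (ground y)
    above : ∀ {p} → w ≡ ground p → (1 ∷ p) ∉ ws → Reply w ws (1 ∷ p)
    distant : ∀ {x} → fresh (w ∷ ws) ≤ head x → head x < fresh (w ∷ ws) + suc b → Reply w ws x

  cap-reply : ∀ p ws → Reply (ground p) ws (cap p ws)
  cap-reply p ws with (1 ∷ p) ∈? ws
  ... | yes _ = distant ≤-refl (m<m+n _ (s≤s z≤n))
  ... | no 1p∉ws = above refl 1p∉ws

  0<head-cap : ∀ p ws → 0 < head (cap p ws)
  0<head-cap p ws with (1 ∷ p) ∈? ws
  ... | yes _ = s≤s z≤n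
  ... | no _ = s≤s z≤n

  reply : ∀ w ws {x} → x ∈ toList (τ (w ∷ ws)) → Reply w ws x
  reply (zero ∷ p) ws (here refl) = cap-reply p ws
  reply (zero ∷ p) ws (there i) rewrite toList-map ground (σ (p ∷ groundMoves ws))
    with ∈-map⁻ ground i
  ... | y , y∈ , refl = lifted refl y∈
  reply w@(suc _ ∷ _) ws i with ∈-farBlock (fresh (w ∷ ws)) (suc b) i
  ... | lo , hi = distant lo hi

  ∈-blocked⇒head<fresh+b : ∀ ws {x} → x ∈ blocked τ ws → head x < fresh ws + suc b
  ∈-blocked⇒head<fresh+b (w ∷ ws) i with ∈-++⁻ (toList (τ (w ∷ ws))) i
  ... | inj₂ j =
    <-≤-trans (∈-blocked⇒head<fresh+b ws j) (≤-trans (fresh+b<fresh-∷ w ws) (m≤m+n _ (suc b)))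
  ... | inj₁ j with reply w ws j
  ...   | lifted _ _ = s≤s z≤n
  ...   | above _ _ = s≤s (s≤s z≤n)
  ...   | distant _ hi = hi

  ∈-groundMoves⇒ground∈ : ∀ ws {y} → y ∈ groundMoves ws → ground y ∈ ws
  ∈-groundMoves⇒ground∈ ((zero ∷ p) ∷ ws) (here refl) = here refl
  ∈-groundMoves⇒ground∈ ((zero ∷ p) ∷ ws) (there i) = there (∈-groundMoves⇒ground∈ ws i)
  ∈-groundMoves⇒ground∈ ((suc _ ∷ _) ∷ ws) i = there (∈-groundMoves⇒ground∈ ws i)

  ground∈⇒∈-groundMoves : ∀ ws {y} → ground y ∈ ws → y ∈ groundMoves ws
  ground∈⇒∈-groundMoves ((zero ∷ p) ∷ ws) (here refl) = here refl
  ground∈⇒∈-groundMoves ((zero ∷ p) ∷ ws) (there i) = there (ground∈⇒∈-groundMoves ws i)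
  ground∈⇒∈-groundMoves ((suc _ ∷ _) ∷ ws) (there i) = ground∈⇒∈-groundMoves ws i

  blocked-groundMoves-∷ : ∀ w ws {y} →
    y ∈ blocked σ (groundMoves ws) → y ∈ blocked σ (groundMoves (w ∷ ws))
  blocked-groundMoves-∷ (zero ∷ p) ws = ∈-++⁺ʳ (toList (σ (p ∷ groundMoves ws)))
  blocked-groundMoves-∷ (suc _ ∷ _) ws i = i

  ∈-blocked⇒ground∈blocked : ∀ ws {y} → y ∈ blocked σ (groundMoves ws) → ground y ∈ blocked τ ws
  ∈-blocked⇒ground∈blocked ((zero ∷ p) ∷ ws) i with ∈-++⁻ (toList (σ (p ∷ groundMoves ws))) i
  ... | inj₁ j = ∈-++⁺ˡ (there (subst (_ ∈_) (sym (toList-map ground _)) (∈-map⁺ ground j)))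
  ... | inj₂ j = ∈-++⁺ʳ (toList (τ ((zero ∷ p) ∷ ws))) (∈-blocked⇒ground∈blocked ws j)
  ∈-blocked⇒ground∈blocked (w@(suc _ ∷ _) ∷ ws) i =
    ∈-++⁺ʳ (toList (τ (w ∷ ws))) (∈-blocked⇒ground∈blocked ws i)

  ground∈blocked⇒∈-blocked : ∀ ws {y} → ground y ∈ blocked τ ws → y ∈ blocked σ (groundMoves ws)
  ground∈blocked⇒∈-blocked (w ∷ ws) i with ∈-++⁻ (toList (τ (w ∷ ws))) i
  ... | inj₂ j = blocked-groundMoves-∷ w ws (ground∈blocked⇒∈-blocked ws j)
  ... | inj₁ j with reply w ws j
  ...   | lifted refl y∈ = ∈-++⁺ˡ y∈
  ...   | distant () _

  above∈blocked⇒ground∈ : ∀ ws {p} → (1 ∷ p) ∈ blocked τ ws → ground p ∈ ws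
  above∈blocked⇒ground∈ (w ∷ ws) i with ∈-++⁻ (toList (τ (w ∷ ws))) i
  ... | inj₂ j = there (above∈blocked⇒ground∈ ws j)
  ... | inj₁ j with reply w ws j
  ...   | above refl _ = here refl
  ...   | distant (s≤s ()) _

  legal-groundMoves : ∀ ws → Legal τ ws → Legal σ (groundMoves ws)
  legal-groundMoves [] _ = tt
  legal-groundMoves ((zero ∷ p) ∷ ws) (legal , w∉ws , w∉blocked) =
    legal-groundMoves ws legal ,
    w∉ws ∘ ∈-groundMoves⇒ground∈ ws ,
    w∉blocked ∘ ∈-blocked⇒ground∈blocked ws
  legal-groundMoves ((suc _ ∷ _) ∷ ws) (legal , _ , _) = legal-groundMoves ws legal

  reply-unique : RespondsFreshly σ → ∀ w ws → Legal τ (w ∷ ws) → Unique (toList (τ (w ∷ ws)))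
  reply-unique σ-fresh (zero ∷ p) ws legal = ¬Any⇒All¬ _ cap∉lifted ∷ lifted-unique
    where
    cap∉lifted : cap p ws ∉ toList (Vec.map ground (σ (p ∷ groundMoves ws)))
    cap∉lifted i rewrite toList-map ground (σ (p ∷ groundMoves ws)) with ∈-map⁻ ground i
    ... | _ , _ , cap≡ground = <-irrefl (cong head (sym cap≡ground)) (0<head-cap p ws)
    lifted-unique : Unique (toList (Vec.map ground (σ (p ∷ groundMoves ws))))
    lifted-unique rewrite toList-map ground (σ (p ∷ groundMoves ws)) =
      Unique.map⁺ ∷-injectiveʳ
        (proj₁ (σ-fresh p (groundMoves ws) (legal-groundMoves (ground p ∷ ws) legal)))
  reply-unique _ w@(suc _ ∷ _) ws _ = farBlock-unique (fresh (w ∷ ws)) (suc b)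

  reply-fresh : RespondsFreshly σ → ∀ w ws → Legal τ (w ∷ ws) →
    Disjoint (toList (τ (w ∷ ws))) ((w ∷ ws) ++ blocked τ ws)
  reply-fresh σ-fresh w ws legal@(_ , w∉ws , _) (i , j) with reply w ws i
  ... | lifted {p} refl y∈ =
    proj₂ (σ-fresh p (groundMoves ws) (legal-groundMoves (w ∷ ws) legal))
      (y∈ , [ ∈-++⁺ˡ ∘ ground∈⇒∈-groundMoves (w ∷ ws)
            , ∈-++⁺ʳ (groundMoves (w ∷ ws)) ∘ ground∈blocked⇒∈-blocked ws
            ] (∈-++⁻ (w ∷ ws) j))
  ... | above refl 1p∉ws =
    [ (λ { (there k) → 1p∉ws k }) , w∉ws ∘ above∈blocked⇒ground∈ ws ] (∈-++⁻ (w ∷ ws) j)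
  ... | distant lo _ =
    [ (λ k → <⇒≱ (∈⇒head<fresh (w ∷ ws) k) lo)
    , (λ k → <⇒≱ (<-≤-trans (∈-blocked⇒head<fresh+b ws k) (fresh+b<fresh-∷ w ws)) lo)
    ] (∈-++⁻ (w ∷ ws) j)

  respondsFreshly : RespondsFreshly σ → RespondsFreshly τ
  respondsFreshly σ-fresh w ws legal =
    reply-unique σ-fresh w ws legal , reply-fresh σ-fresh w ws legal

  above-taken : ∀ ws {p} → ground p ∈ ws → (1 ∷ p) ∈ ws ⊎ (1 ∷ p) ∈ blocked τ ws
  above-taken (w ∷ ws) {p} (here refl) with (1 ∷ p) ∈? ws
  ... | yes i = inj₁ (there i)
  ... | no _ = inj₂ (here refl)
  above-taken (w ∷ ws) (there i) =
    Sum.map there (∈-++⁺ʳ (toList (τ (w ∷ ws)))) (above-taken ws i)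

  -- The sublist is newest first: (1, p) would be played after (0, p).
  no-above-after-ground : ∀ ws → Legal τ ws → ∀ {p} → ((1 ∷ p) ∷ ground p ∷ []) ⊆ ws → ⊥
  no-above-after-ground (w ∷ ws) (legal , _ , _) (_ ∷ʳ s) = no-above-after-ground ws legal s
  no-above-after-ground (w ∷ ws) (_ , w∉ws , w∉blocked) (refl ∷ s) =
    [ w∉ws , w∉blocked ] (above-taken ws (to∈ s))

  walkFrom-ground⇒map-ground : ∀ ws → Legal τ ws → ∀ p ys →
    (ground p ∷ ys) ⊆ reverse ws → WalkFrom (ground p) ys →
    ∃[ ps ] WalkFrom p ps × List.map ground ps ≡ ys
  walkFrom-ground⇒map-ground ws legal p [] _ _ = [] , tt , refl
  walkFrom-ground⇒map-ground ws legal p (_ ∷ ys) s ((fzero , refl) , _) =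
    ⊥-elim (no-above-after-ground ws legal (reverse⁻ (⊆-trans (refl ∷ refl ∷ minimum ys) s)))
  walkFrom-ground⇒map-ground ws legal p (_ ∷ ys) s ((fsuc i , refl) , walk)
    with walkFrom-ground⇒map-ground ws legal (updateAt p i suc) ys (∷ˡ⁻ s) walk
  ... | ps , walk′ , refl = updateAt p i suc ∷ ps , ((i , refl) , walk′) , refl

  map-ground-⊆⇒⊆-groundMoves : ∀ ps ws → List.map ground ps ⊆ ws → ps ⊆ groundMoves ws
  map-ground-⊆⇒⊆-groundMoves [] [] [] = []
  map-ground-⊆⇒⊆-groundMoves ps ((zero ∷ q) ∷ ws) (_ ∷ʳ s) =
    q ∷ʳ map-ground-⊆⇒⊆-groundMoves ps ws s
  map-ground-⊆⇒⊆-groundMoves ps ((suc _ ∷ _) ∷ ws) (_ ∷ʳ s) = map-ground-⊆⇒⊆-groundMoves ps ws s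
  map-ground-⊆⇒⊆-groundMoves (p ∷ ps) (_ ∷ ws) (refl ∷ s) = refl ∷ map-ground-⊆⇒⊆-groundMoves ps ws s

  map-ground-⊆-reverse⇒⊆-reverse-groundMoves : ∀ ps ws →
    List.map ground ps ⊆ reverse ws → ps ⊆ reverse (groundMoves ws)
  map-ground-⊆-reverse⇒⊆-reverse-groundMoves ps ws s =
    subst (_⊆ reverse (groundMoves ws)) (reverse-involutive ps)
      (reverse⁺ (map-ground-⊆⇒⊆-groundMoves (reverse ps) ws
        (subst₂ _⊆_ (sym (reverse-map ground ps)) (reverse-involutive ws) (reverse⁺ s))))

  walkerWins-groundMoves : ∀ {k} ws → Legal τ ws →
    WalkerWins k (reverse ws) → WalkerWins k (reverse (groundMoves ws))
  walkerWins-groundMoves ws _ ([] , length≡ , _ , _) = [] , length≡ , tt , minimum _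
  walkerWins-groundMoves ws legal (_ ∷ ys , length≡ , (refl , walk) , s)
    with walkFrom-ground⇒map-ground ws legal (origin d) ys s walk
  ... | ps , walk′ , refl =
    origin d ∷ ps ,
    trans (cong suc (sym (length-map ground ps))) length≡ ,
    (refl , walk′) ,
    map-ground-⊆-reverse⇒⊆-reverse-groundMoves (origin d ∷ ps) ws s

  blocks : ∀ {k} → Blocks σ k → Blocks τ k
  blocks σ-blocks ws legal =
    σ-blocks (groundMoves ws) (legal-groundMoves ws legal) ∘ walkerWins-groundMoves ws legal

proposition17 : (b d : ℕ) → 1 ≤ b → 1 ≤ d →
    BlockerWinsPrefix b d → BlockerWinsPrefix (suc b) (suc d)
proposition17 b d _ _ (k , σ , σ-wins) with winning⇒respondsFreshly×blocks σ-wins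
... | σ-fresh , σ-blocks =
  k , Lift.τ σ ,
  respondsFreshly×blocks⇒winning (Lift.respondsFreshly σ σ-fresh) (Lift.blocks σ σ-blocks)
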